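{- Let $n\ge 2$ and $1\le k<n$ with $\gcd(n,k)=1$. The number ${C^\ast}^k_n$ of circular permutations of $[n]$ that avoid all substrings $j(j+k)\pmod n$, $1\le j\le n$, is $${C^\ast}^k_n=\sum_{j=0}^{n-1}(-1)^j\binom{n}{j}(n-j-1)!+(-1)^n.$$
   Context: A circular permutation of $[n]=\{1,\dots,n\}$ is an arrangement of $1,\dots,n$ around a circle up to rotation (a cyclic order, written in cycle notation). It avoids the substrings $j(j+k)\pmod n$ for all $j$ if there is no element $a$ whose immediate successor $b$ in the cyclic order satisfies $b\equiv a+k\pmod n$ (residues taken in $\{1,\dots,n\}$, writing $n$ for $0$). -}

module Defs where

open import Data.Nat using (ℕ; zero; suc; _+_; _∸_; _!)
open import Data.Nat.DivMod using (_%_)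
open import Data.Nat.Combinatorics using (_C_)
open import Data.Fin using (Fin; toℕ)
import Data.Fin.Properties as FinP
open import Data.List using (List; []; _∷_; _++_; [_]; zip; map; concatMap; filter; length; foldr; upTo; allFin)
open import Data.List.Relation.Unary.All using (All; all?)
open import Data.List.Relation.Unary.Unique.Propositional using (Unique)
open import Data.List.Relation.Unary.Unique.DecPropositional using (unique?)
open import Data.Product using (_×_; _,_)
open import Data.Integer as ℤ using (ℤ; -1ℤ; +_)
open import Relation.Binary.PropositionalEquality using (_≡_)
open import Relation.Nullary using (¬_; Dec; ¬?)
open import Relation.Nullary.Decidable using (_×-dec_)
import Data.Nat as ℕ

-- Residue of x modulo n (for n = 0 unused; returns x).
modN : ℕ → ℕ → ℕ
modN zero    x = x
modN (suc m) x = x % suc m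

allLists : (n m : ℕ) → List (List (Fin n))
allLists n zero    = [] ∷ []
allLists n (suc m) = concatMap (λ i → map (i ∷_) (allLists n m)) (allFin n)

cyclicPairs : {A : Set} → List A → List (A × A)
cyclicPairs []       = []
cyclicPairs (x ∷ xs) = zip (x ∷ xs) (xs ++ [ x ])

-- Elements of [n] are encoded by Fin n via j ↦ j - 1 (so 1 ↦ 0, n ↦ n-1);
-- the congruence b ≡ a + k (mod n) is invariant under this shift.
-- A circular permutation of [n] (a cyclic order up to rotation) is
-- represented by its unique rotation starting with the element 1 (Fin 0):
-- a list of the n elements, each occurring exactly once, whose head is 1.
StartsWith1 : {n : ℕ} → List (Fin n) → Set
StartsWith1 []      = Data.Empty.⊥ where import Data.Empty
StartsWith1 (x ∷ _) = toℕ x ≡ 0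

startsWith1? : {n : ℕ} → (l : List (Fin n)) → Dec (StartsWith1 l)
startsWith1? []      = Relation.Nullary.no (λ ())
startsWith1? (x ∷ _) = toℕ x ℕ.≟ 0

IsCircRep : (n : ℕ) → List (Fin n) → Set
IsCircRep n l = StartsWith1 l × Unique l

Avoids : (n k : ℕ) → List (Fin n) → Set
Avoids n k l = All (λ p → ¬ (toℕ (Data.Product.proj₂ p) ≡ modN n (toℕ (Data.Product.proj₁ p) + k))) (cyclicPairs l)
  where import Data.Product

avoids? : (n k : ℕ) → (l : List (Fin n)) → Dec (Avoids n k l)
avoids? n k l = all? (λ p → ¬? (toℕ (proj₂ p) ℕ.≟ modN n (toℕ (proj₁ p) + k))) (cyclicPairs l)
  where open Data.Product using (proj₁; proj₂)

good? : (n k : ℕ) → (l : List (Fin n)) → Dec (IsCircRep n l × Avoids n k l)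
good? n k l = (startsWith1? l ×-dec unique? FinP._≟_ l) ×-dec avoids? n k l

circAvoidCount : (n k : ℕ) → ℕ
circAvoidCount n k = length (filter (good? n k) (allLists n n))

rhs : ℕ → ℤ
rhs n = foldr ℤ._+_ (+ 0) (map term (upTo n)) ℤ.+ (-1ℤ ℤ.^ n)
  where
  term : ℕ → ℤ
  term j = (-1ℤ ℤ.^ j) ℤ.* (+ ((n C j) ℕ.* ((n ∸ j ∸ 1) !)))

-- Multiplication by k permutes ℤ/n, fixes 0 and turns every step a ↦ a + 1 into a ↦ a + k, so
-- relabelling by it reduces the count to k = 1, i.e. to circular permutations without a
-- succession a(a+1) (mod n).  Number the entries 0, …, n − 1 and let F(n, t) count the circular
-- permutations with no succession a(a+1) for a ≥ t; thus F(n, n) = (n − 1)! and F(n, 0) is the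
-- number sought.  For t ≤ n, the permutations counted by F(n + 1, t + 1) that contain the
-- succession t(t+1) correspond to those counted by F(n, t): contract t(t+1) to the single point t
-- and shift the larger entries down, which keeps every succession a(a+1) with a > t (for t = n the
-- succession n0 simply disappears).  Hence F(n + 1, t + 1) = F(n, t) + F(n + 1, t).  By Pascal's
-- rule A(n, e) = Σ_{j ≤ e} (−1)^j C(e, j) (n − j − 1)! satisfies A(n + 1, e + 1) =
-- A(n + 1, e) − A(n, e) and A(n, 0) = (n − 1)!, so F(n, t) = A(n, n − t), and A(n, n) is the
-- right-hand side of the theorem.

module Submission where

open import Defs
open import Data.Nat using (ℕ; _≤_; _<_)
open import Data.Nat.GCD using (gcd)
open import Data.Integer using (+_)
open import Relation.Binary.PropositionalEquality using (_≡_)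

open import Data.Fin as Fin using (Fin; toℕ; punchIn; punchOut)
import Data.Fin.Properties as FinP
open import Data.Integer as ℤ using (ℤ; -1ℤ)
import Data.Integer.Properties as ℤP
open import Algebra.Properties.AbelianGroup ℤP.+-0-abelianGroup using (∙-cancelʳ)
open import Algebra.Properties.CommutativeMonoid.Sum ℤP.+-0-commutativeMonoid
  using (sum; sum-init-last; sum-cong-≗; ∑-distrib-+)
open import Data.Integer.Tactic.RingSolver using (solve-∀)
open import Data.List
  using (List; []; _∷_; _++_; [_]; map; filter; length; zip; foldr; applyUpTo; allFin; concatMap; cartesianProductWith)
open import Data.List.Membership.Propositional using (_∈_; find; lose)
open import Data.List.Membership.Propositional.Properties
  using (∈-map⁻; ∈-map⁺; ∈-filter⁺; ∈-filter⁻; ∈-allFin; ∈-++⁺ʳ; ∈-∃++;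
         ∈-cartesianProductWith⁺; ∈-cartesianProductWith⁻)
open import Data.List.Membership.Propositional.Properties.WithK using (unique∧set⇒bag)
open import Data.List.Properties
  using (∷-injective; ∷-injectiveˡ; length-map; length-++; length-tabulate; ++-identityʳ;
         map-++; map-∘; map-id; map-cong; map-id-local; filter-++; filter-≐; filter-all)
open import Data.List.Relation.Binary.BagAndSetEquality using (∼bag⇒↭)
open import Data.List.Relation.Binary.Permutation.Propositional.Properties using (↭-length)
open import Data.List.Relation.Unary.All as All using (All; []; _∷_)
import Data.List.Relation.Unary.All.Properties as AllP
open import Data.List.Relation.Unary.AllPairs using ([]; _∷_)
open import Data.List.Relation.Unary.Any as Any using (Any; here; there)
open import Data.List.Relation.Unary.Any.Properties using (Any-⊎⁻)
open import Data.List.Relation.Unary.Unique.DecPropositional using (unique?)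
open import Data.List.Relation.Unary.Unique.Propositional using (Unique)
import Data.List.Relation.Unary.Unique.Propositional.Properties as Unique
open import Data.Nat using (zero; suc; _+_; _*_; _∸_; _!; z≤n; s≤s; NonZero; pred)
open import Data.Nat.Combinatorics using (_C_; nCk+nC[k+1]≡[n+1]C[k+1]; k>n⇒nCk≡0; nCn≡1)
open import Data.Nat.Coprimality using (gcd≡1⇒coprime; coprime-Bézout)
open import Data.Nat.DivMod
  using (_%_; _mod_; %-distribˡ-*; %-distribˡ-+; m%n%n≡m%n; [m+n]%n≡m%n; [m+kn]%n≡m%n; m<n⇒m%n≡m; n%n≡0)
open import Data.Nat.GCD using (module Bézout)
open import Data.Nat.Properties
import Data.Nat.Tactic.RingSolver as ℕ-Solver
import Data.Product as Product
open import Data.Product using (∃; ∃₂; _×_; _,_; proj₁; proj₂)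
open import Data.Sum using (_⊎_; inj₁; inj₂; [_,_]′)
open import Function using (id; _∘_; _⇔_; mk⇔; Equivalence)
open import Relation.Binary.Definitions using (tri<; tri≈; tri>)
open import Relation.Binary.PropositionalEquality hiding ([_])
open import Relation.Nullary using (¬_; Dec; yes; no; ¬?; contradiction; _×-dec_)
open import Relation.Unary using (Decidable; _≐_)
open import Relation.Unary.Properties using (_∩?_; ∁?)

private
  variable
    A B : Set
    m n : ℕ

map-leftInverse : ∀ (f : A → B) g → (∀ a → g (f a) ≡ a) → ∀ xs → map g (map f xs) ≡ xs
map-leftInverse f g g∘f xs = trans (sym (map-∘ xs)) (trans (map-cong g∘f xs) (map-id xs))

leftInverse⇒injective : ∀ (f : A → B) g → (∀ a → g (f a) ≡ a) → ∀ {a a′} → f a ≡ f a′ → a ≡ a′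
leftInverse⇒injective f g g∘f {a} {a′} fa≡fa′ =
  trans (sym (g∘f a)) (trans (cong g fa≡fa′) (g∘f a′))

concatMap-map≡cartesianProductWith : ∀ (f : A → B → B) xs (ys : List B) →
  concatMap (λ x → map (f x) ys) xs ≡ cartesianProductWith f xs ys
concatMap-map≡cartesianProductWith f []       ys = refl
concatMap-map≡cartesianProductWith f (x ∷ xs) ys =
  cong (map (f x) ys ++_) (concatMap-map≡cartesianProductWith f xs ys)

length-filter-map : ∀ {P : B → Set} (P? : Decidable P) (f : A → B) xs →
  length (filter P? (map f xs)) ≡ length (filter (P? ∘ f) xs)
length-filter-map P? f []       = refl
length-filter-map P? f (x ∷ xs) with P? (f x)
... | yes _ = cong suc (length-filter-map P? f xs)
... | no  _ = length-filter-map P? f xs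

length-filter-split : ∀ {P Q : A → Set} (P? : Decidable P) (Q? : Decidable Q) xs →
  length (filter P? xs) ≡ length (filter (P? ∩? Q?) xs) + length (filter (P? ∩? ∁? Q?) xs)
length-filter-split P? Q? []       = refl
length-filter-split P? Q? (x ∷ xs) with P? x | Q? x
... | yes _ | yes _ = cong suc (length-filter-split P? Q? xs)
... | yes _ | no  _ = trans (cong suc (length-filter-split P? Q? xs)) (sym (+-suc _ _))
... | no  _ | _     = length-filter-split P? Q? xs

length-filter-cartesianProductWith : ∀ {X : Set} {P : X → Set} (P? : Decidable P) (f : A → B → X) xs ys {c} →
  (∀ x → length (filter P? (map (f x) ys)) ≡ c) →
  length (filter P? (cartesianProductWith f xs ys)) ≡ length xs * c
length-filter-cartesianProductWith P? f []       ys eq = refl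
length-filter-cartesianProductWith P? f (x ∷ xs) ys eq = begin
  length (filter P? (map (f x) ys ++ cartesianProductWith f xs ys))
    ≡⟨ cong length (filter-++ P? (map (f x) ys) _) ⟩
  length (filter P? (map (f x) ys) ++ filter P? (cartesianProductWith f xs ys))
    ≡⟨ length-++ (filter P? (map (f x) ys)) ⟩
  length (filter P? (map (f x) ys)) + length (filter P? (cartesianProductWith f xs ys))
    ≡⟨ cong₂ _+_ (eq x) (length-filter-cartesianProductWith P? f xs ys eq) ⟩
  _ + length xs * _ ∎
  where open ≡-Reasoning

consIf : ∀ {P : Set} → Dec P → A → List A → List A
consIf (yes _) x xs = x ∷ xs
consIf (no  _) _ xs = xs

unique-++⁻ʳ : ∀ (xs : List A) {ys} → Unique (xs ++ ys) → Unique ys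
unique-++⁻ʳ []       u       = u
unique-++⁻ʳ (_ ∷ xs) (_ ∷ u) = unique-++⁻ʳ xs u

unique-++-fresh : ∀ (xs : List A) {ys y} → Unique (xs ++ ys) → y ∈ ys → All (y ≢_) xs
unique-++-fresh []       u        y∈ = []
unique-++-fresh (x ∷ xs) (x∉ ∷ u) y∈ =
  (λ y≡x → All.lookup x∉ (∈-++⁺ʳ xs y∈) (sym y≡x)) ∷ unique-++-fresh xs u y∈

unique-insertAfter : ∀ (xs : List A) {x ys y} →
  Unique (xs ++ x ∷ ys) → All (y ≢_) (xs ++ x ∷ ys) → Unique (xs ++ x ∷ y ∷ ys)
unique-insertAfter []        (x∉ ∷ u) (y≢x ∷ y∉) = ((y≢x ∘ sym) ∷ x∉) ∷ y∉ ∷ u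
unique-insertAfter (x′ ∷ xs) (x′∉ ∷ u) (y≢x′ ∷ y∉) =
  insert (AllP.++⁻ˡ xs x′∉) (AllP.++⁻ʳ xs x′∉) ∷ unique-insertAfter xs u y∉
  where
  insert : ∀ {x ys} → All (x′ ≢_) xs → All (x′ ≢_) (x ∷ ys) → All (x′ ≢_) (xs ++ x ∷ _ ∷ ys)
  insert x′∉xs (x′≢x ∷ x′∉ys) = AllP.++⁺ x′∉xs (x′≢x ∷ (y≢x′ ∘ sym) ∷ x′∉ys)

-- cyclicPairs (x ∷ xs) is definitionally chainPairs x xs x.
chainPairs : A → List A → A → List (A × A)
chainPairs x xs h = zip (x ∷ xs) (xs ++ [ h ])

∈-chainPairs⁻ : ∀ {a b x h : A} xs → (a , b) ∈ chainPairs x xs h →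
  (∃₂ λ p q → x ∷ xs ≡ p ++ a ∷ b ∷ q) ⊎ (b ≡ h × ∃ λ p → x ∷ xs ≡ p ++ [ a ])
∈-chainPairs⁻ []       (here refl)  = inj₂ (refl , [] , refl)
∈-chainPairs⁻ (y ∷ ys) (here refl)  = inj₁ ([] , ys , refl)
∈-chainPairs⁻ {x = x} (y ∷ ys) (there ab∈) with ∈-chainPairs⁻ ys ab∈
... | inj₁ (p , q , eq)     = inj₁ (x ∷ p , q , cong (x ∷_) eq)
... | inj₂ (b≡h , p , eq)   = inj₂ (b≡h , x ∷ p , cong (x ∷_) eq)

∈-chainPairs⁺ : ∀ {a b x h : A} {xs q} p → x ∷ xs ≡ p ++ a ∷ b ∷ q → (a , b) ∈ chainPairs x xs h
∈-chainPairs⁺ []            refl = here refl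
∈-chainPairs⁺ (_ ∷ [])      refl = there (here refl)
∈-chainPairs⁺ (_ ∷ y ∷ p)   refl = there (∈-chainPairs⁺ (y ∷ p) refl)

∈-chainPairs⁺-last : ∀ {a x h : A} {xs} p → x ∷ xs ≡ p ++ [ a ] → (a , h) ∈ chainPairs x xs h
∈-chainPairs⁺-last []          refl = here refl
∈-chainPairs⁺-last (_ ∷ [])    refl = there (here refl)
∈-chainPairs⁺-last (_ ∷ y ∷ p) refl = there (∈-chainPairs⁺-last (y ∷ p) refl)

chainPairs-map : ∀ (f : A → B) x xs h →
  chainPairs (f x) (map f xs) (f h) ≡ map (Product.map f f) (chainPairs x xs h)
chainPairs-map f x []       h = refl
chainPairs-map f x (y ∷ ys) h = cong ((f x , f y) ∷_) (chainPairs-map f y ys h)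

cyclicPairs-map : ∀ (f : A → B) xs → cyclicPairs (map f xs) ≡ map (Product.map f f) (cyclicPairs xs)
cyclicPairs-map f []       = refl
cyclicPairs-map f (x ∷ xs) = chainPairs-map f x xs x

-- Counting lists of a given length

allLists-suc : ∀ n m → allLists n (suc m) ≡ cartesianProductWith _∷_ (allFin n) (allLists n m)
allLists-suc n m = concatMap-map≡cartesianProductWith _∷_ (allFin n) (allLists n m)

∈-allLists⁻ : ∀ m {l : List (Fin n)} → l ∈ allLists n m → length l ≡ m
∈-allLists⁻ zero    (here refl) = refl
∈-allLists⁻ {n} (suc m) l∈ with ∈-cartesianProductWith⁻ _∷_ (allFin n) (allLists n m)
                                   (subst (_ ∈_) (allLists-suc n m) l∈)
... | _ , _ , _ , t∈ , refl = cong suc (∈-allLists⁻ m t∈)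

∈-allLists⁺ : ∀ (l : List (Fin n)) → l ∈ allLists n (length l)
∈-allLists⁺ []      = here refl
∈-allLists⁺ {n} (x ∷ l) = subst (_ ∈_) (sym (allLists-suc n (length l)))
  (∈-cartesianProductWith⁺ _∷_ (∈-allFin x) (∈-allLists⁺ l))

allLists-unique : ∀ n m → Unique (allLists n m)
allLists-unique n zero    = [] ∷ []
allLists-unique n (suc m) = subst Unique (sym (allLists-suc n m))
  (Unique.cartesianProductWith⁺ _∷_ ∷-injective (Unique.allFin⁺ n) (allLists-unique n m))

count : ∀ n m {P : List (Fin n) → Set} → Decidable P → ℕ
count n m P? = length (filter P? (allLists n m))

module _ {n n′ m m′ : ℕ} {P : List (Fin n) → Set} {Q : List (Fin n′) → Set}
         (P? : Decidable P) (Q? : Decidable Q)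
         (f : List (Fin n) → List (Fin n′)) (g : List (Fin n′) → List (Fin n))
         (f-maps : ∀ {l} → length l ≡ m → P l → length (f l) ≡ m′ × Q (f l))
         (g-maps : ∀ {l} → length l ≡ m′ → Q l → length (g l) ≡ m × P (g l))
         (g∘f : ∀ {l} → P l → g (f l) ≡ l)
         (f∘g : ∀ {l} → Q l → f (g l) ≡ l)
         where

  private
    xs : List (List (Fin n))
    xs = filter P? (allLists n m)

    ys : List (List (Fin n′))
    ys = filter Q? (allLists n′ m′)

    ∈xs⁻ : ∀ {l} → l ∈ xs → length l ≡ m × P l
    ∈xs⁻ l∈ with l∈all , pl ← ∈-filter⁻ P? l∈ = ∈-allLists⁻ m l∈all , pl

    ∈ys⁻ : ∀ {l} → l ∈ ys → length l ≡ m′ × Q l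
    ∈ys⁻ l∈ with l∈all , ql ← ∈-filter⁻ Q? l∈ = ∈-allLists⁻ m′ l∈all , ql

    ∈xs⁺ : ∀ {l} → length l ≡ m → P l → l ∈ xs
    ∈xs⁺ refl pl = ∈-filter⁺ P? (∈-allLists⁺ _) pl

    ∈ys⁺ : ∀ {l} → length l ≡ m′ → Q l → l ∈ ys
    ∈ys⁺ refl ql = ∈-filter⁺ Q? (∈-allLists⁺ _) ql

    map-f-unique : Unique (map f xs)
    map-f-unique = Unique.map⁻ (subst Unique (sym g∘f-xs) (Unique.filter⁺ P? (allLists-unique n m)))
      where
      g∘f-xs : map g (map f xs) ≡ xs
      g∘f-xs = trans (sym (map-∘ xs)) (map-id-local (All.tabulate (g∘f ∘ proj₂ ∘ ∈xs⁻)))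

    map-f⊆ys : ∀ {l} → l ∈ map f xs → l ∈ ys
    map-f⊆ys l∈ with _ , l′∈ , refl ← ∈-map⁻ f l∈ with len , pl ← ∈xs⁻ l′∈ =
      ∈ys⁺ (proj₁ (f-maps len pl)) (proj₂ (f-maps len pl))

    ys⊆map-f : ∀ {l} → l ∈ ys → l ∈ map f xs
    ys⊆map-f l∈ with len , ql ← ∈ys⁻ l∈ with len′ , pgl ← g-maps len ql =
      subst (_∈ map f xs) (f∘g ql) (∈-map⁺ f (∈xs⁺ len′ pgl))

  count-bijection : count n m P? ≡ count n′ m′ Q?
  count-bijection = trans (sym (length-map f xs)) (↭-length (∼bag⇒↭ (unique∧set⇒bag
    map-f-unique (Unique.filter⁺ Q? (allLists-unique n′ m′)) (mk⇔ map-f⊆ys ys⊆map-f))))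

count-cong : ∀ {n m} {P Q : List (Fin n) → Set} (P? : Decidable P) (Q? : Decidable Q) →
  (∀ {l} → P l → Q l) → (∀ {l} → Q l → P l) → count n m P? ≡ count n m Q?
count-cong {m = m} P? Q? P⇒Q Q⇒P = count-bijection {m = m} {m′ = m} P? Q? id id
  (λ len p → len , P⇒Q p) (λ len q → len , Q⇒P q) (λ _ → refl) (λ _ → refl)

count-split : ∀ {P Q : List (Fin n) → Set} (P? : Decidable P) (Q? : Decidable Q) →
  count n m P? ≡ count n m (P? ∩? Q?) + count n m (P? ∩? ∁? Q?)
count-split {n} {m} P? Q? = length-filter-split P? Q? (allLists n m)

-- Deleting an element and renumbering

remove : Fin (suc n) → List (Fin (suc n)) → List (Fin n)
remove h []       = []
remove h (y ∷ ys) with h Fin.≟ y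
... | yes _   = remove h ys
... | no h≢y = punchOut h≢y ∷ remove h ys

module _ {h : Fin (suc n)} where

  remove-self : ∀ ys → remove h (h ∷ ys) ≡ remove h ys
  remove-self ys with h Fin.≟ h
  ... | yes _   = refl
  ... | no h≢h = contradiction refl h≢h

  remove-other : ∀ {y} ys (h≢y : h ≢ y) → remove h (y ∷ ys) ≡ punchOut h≢y ∷ remove h ys
  remove-other {y} ys h≢y with h Fin.≟ y
  ... | yes h≡y  = contradiction h≡y h≢y
  ... | no h≢y′ = cong (_∷ remove h ys) (FinP.punchOut-cong h refl)

  remove-++ : ∀ xs ys → remove h (xs ++ ys) ≡ remove h xs ++ remove h ys
  remove-++ []       ys = refl
  remove-++ (x ∷ xs) ys with h Fin.≟ x
  ... | yes _ = remove-++ xs ys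
  ... | no  _ = cong (_ ∷_) (remove-++ xs ys)

  remove-map-punchIn : ∀ (ys : List (Fin n)) → remove h (map (punchIn h) ys) ≡ ys
  remove-map-punchIn []       = refl
  remove-map-punchIn (y ∷ ys) = begin
    remove h (punchIn h y ∷ map (punchIn h) ys)
      ≡⟨ remove-other _ (FinP.punchInᵢ≢i h y ∘ sym) ⟩
    punchOut (FinP.punchInᵢ≢i h y ∘ sym) ∷ remove h (map (punchIn h) ys)
      ≡⟨ cong₂ _∷_ (FinP.punchOut-punchIn h) (remove-map-punchIn ys) ⟩
    y ∷ ys ∎
    where open ≡-Reasoning

  map-punchIn-remove : ∀ ys → map (punchIn h) (remove h ys) ≡ filter (¬? ∘ (h Fin.≟_)) ys
  map-punchIn-remove []       = refl
  map-punchIn-remove (y ∷ ys) with h Fin.≟ y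
  ... | yes _   = map-punchIn-remove ys
  ... | no h≢y = cong₂ _∷_ (FinP.punchIn-punchOut h≢y) (map-punchIn-remove ys)

  map-punchIn-remove-∉ : ∀ {ys} → All (h ≢_) ys → map (punchIn h) (remove h ys) ≡ ys
  map-punchIn-remove-∉ {ys} h∉ = trans (map-punchIn-remove ys) (filter-all (¬? ∘ (h Fin.≟_)) h∉)

  remove-unique : ∀ {ys} → Unique ys → Unique (remove h ys)
  remove-unique {ys} u =
    Unique.map⁻ (subst Unique (sym (map-punchIn-remove ys)) (Unique.filter⁺ (¬? ∘ (h Fin.≟_)) u))

  length-remove-∉ : ∀ {ys} → All (h ≢_) ys → length (remove h ys) ≡ length ys
  length-remove-∉ {ys} h∉ =
    trans (sym (length-map (punchIn h) (remove h ys))) (cong length (map-punchIn-remove-∉ h∉))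

  length-remove-∈ : ∀ {ys} → Unique ys → h ∈ ys → suc (length (remove h ys)) ≡ length ys
  length-remove-∈ {y ∷ ys} (h∉ys ∷ u) h∈ with h Fin.≟ y
  ... | yes refl = cong suc (length-remove-∉ h∉ys)
  length-remove-∈ {y ∷ ys} (_ ∷ u) (here h≡y)   | no h≢y = contradiction h≡y h≢y
  length-remove-∈ {y ∷ ys} (_ ∷ u) (there h∈ys) | no _   = cong suc (length-remove-∈ u h∈ys)

  punchIn-fresh : ∀ (ys : List (Fin n)) → All (h ≢_) (map (punchIn h) ys)
  punchIn-fresh []       = []
  punchIn-fresh (y ∷ ys) = (FinP.punchInᵢ≢i h y ∘ sym) ∷ punchIn-fresh ys

  punchIn-unique : ∀ {ys : List (Fin n)} → Unique ys → Unique (map (punchIn h) ys)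
  punchIn-unique = Unique.map⁺ (FinP.punchIn-injective h _ _)

unique-length≤ : ∀ {ys : List (Fin n)} → Unique ys → length ys ≤ n
unique-length≤ {ys = []} _ = z≤n
unique-length≤ {suc n} {y ∷ ys} (y∉ ∷ u) =
  s≤s (subst (_≤ n) (length-remove-∉ y∉) (unique-length≤ (remove-unique u)))

unique-full : ∀ {ys : List (Fin n)} → Unique ys → length ys ≡ n → ∀ x → x ∈ ys
unique-full {suc n} {ys} u len x with Any.any? (x Fin.≟_) ys
... | yes x∈ = x∈
... | no  x∉ = contradiction
  (subst (_≤ n) (trans (length-remove-∉ (AllP.¬Any⇒All¬ ys x∉)) len) (unique-length≤ (remove-unique u)))
  (<-irrefl refl)

-- Permutations and circular permutations

uniqueCount : ℕ → ℕ → ℕ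
uniqueCount n r = count n r (unique? Fin._≟_)

Fresh : ∀ {n} → Fin n → List (Fin n) → Set
Fresh h t = All (h ≢_) t × Unique t

fresh? : ∀ {n} (h : Fin n) → Decidable (Fresh h)
fresh? h t = All.all? (¬? ∘ (h Fin.≟_)) t ×-dec unique? Fin._≟_ t

count-fresh : ∀ {n} r (h : Fin (suc n)) → count (suc n) r (fresh? h) ≡ uniqueCount n r
count-fresh r h = count-bijection {m = r} {m′ = r} (fresh? h) (unique? Fin._≟_) (remove h) (map (punchIn h))
  (λ { len (h∉ , u) → trans (length-remove-∉ h∉) len , remove-unique u })
  (λ {l} len u → trans (length-map (punchIn h) l) len , punchIn-fresh l , punchIn-unique u)
  (λ (h∉ , _) → map-punchIn-remove-∉ h∉)
  (λ _ → remove-map-punchIn _)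

uniqueCount-suc : ∀ n r → uniqueCount (suc n) (suc r) ≡ suc n * uniqueCount n r
uniqueCount-suc n r = begin
  uniqueCount (suc n) (suc r)
    ≡⟨ cong (length ∘ filter (unique? Fin._≟_)) (allLists-suc (suc n) r) ⟩
  length (filter (unique? Fin._≟_) (cartesianProductWith _∷_ (allFin (suc n)) (allLists (suc n) r)))
    ≡⟨ length-filter-cartesianProductWith (unique? Fin._≟_) _∷_ (allFin (suc n)) (allLists (suc n) r)
                                          headCount ⟩
  length (allFin (suc n)) * uniqueCount n r
    ≡⟨ cong (_* uniqueCount n r) (length-tabulate {n = suc n} (λ i → i)) ⟩
  suc n * uniqueCount n r ∎
  where
  open ≡-Reasoning
  headCount : ∀ h → length (filter (unique? Fin._≟_) (map (h ∷_) (allLists (suc n) r))) ≡ uniqueCount n r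
  headCount h = begin
    length (filter (unique? Fin._≟_) (map (h ∷_) (allLists (suc n) r)))
      ≡⟨ length-filter-map (unique? Fin._≟_) (h ∷_) (allLists (suc n) r) ⟩
    length (filter (unique? Fin._≟_ ∘ (h ∷_)) (allLists (suc n) r))
      ≡⟨ cong length (filter-≐ (unique? Fin._≟_ ∘ (h ∷_)) (fresh? h) unique⇔fresh (allLists (suc n) r)) ⟩
    count (suc n) r (fresh? h)
      ≡⟨ count-fresh r h ⟩
    uniqueCount n r ∎
    where
    unique⇔fresh : (Unique ∘ (h ∷_)) ≐ Fresh h
    unique⇔fresh = (λ { (h∉ ∷ u) → h∉ , u }) , λ (h∉ , u) → h∉ ∷ u

uniqueCount-full : ∀ n → uniqueCount n n ≡ n !
uniqueCount-full zero    = refl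
uniqueCount-full (suc n) = trans (uniqueCount-suc n n) (cong (suc n *_) (uniqueCount-full n))

isCircRep? : ∀ n → Decidable (IsCircRep n)
isCircRep? n l = startsWith1? l ×-dec unique? Fin._≟_ l

count-circRep : ∀ n → count (suc n) (suc n) (isCircRep? (suc n)) ≡ n !
count-circRep n = trans
  (count-bijection {m = suc n} {m′ = n} (isCircRep? (suc n)) (unique? Fin._≟_)
    (remove Fin.zero) (λ t → Fin.zero ∷ map (punchIn Fin.zero) t)
    (λ { {Fin.zero ∷ t} len (_ , 0∉t ∷ u) →
           trans (length-remove-∉ 0∉t) (suc-injective len) , remove-unique u })
    (λ {t} len u → cong suc (trans (length-map (punchIn Fin.zero) t) len) ,
                   refl , punchIn-fresh {h = Fin.zero} t ∷ punchIn-unique {h = Fin.zero} u)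
    (λ { {Fin.zero ∷ t} (_ , 0∉t ∷ _) → cong (Fin.zero ∷_) (map-punchIn-remove-∉ 0∉t) })
    (λ {t} _ → remove-map-punchIn {h = Fin.zero} t))
  (uniqueCount-full n)

-- Successions

next : Fin (suc m) → Fin (suc m)
next {m} a = suc (toℕ a) mod suc m

toℕ-next : ∀ (a : Fin (suc m)) → toℕ (next a) ≡ suc (toℕ a) % suc m
toℕ-next a = FinP.toℕ-fromℕ< _

toℕ-next-< : ∀ {a : Fin (suc m)} → toℕ a < m → toℕ (next a) ≡ suc (toℕ a)
toℕ-next-< {m} {a} a<m = trans (toℕ-next a) (m<n⇒m%n≡m (s≤s a<m))

next-top : ∀ {a : Fin (suc m)} → toℕ a ≡ m → next a ≡ Fin.zero
next-top {m} {a} a≡m =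
  FinP.toℕ-injective (trans (toℕ-next a) (trans (cong (λ x → suc x % suc m) a≡m) (n%n≡0 (suc m))))

punchIn≡suc : ∀ {n} (i : Fin (suc n)) (j : Fin n) → toℕ i ≤ toℕ j → punchIn i j ≡ Fin.suc j
punchIn≡suc Fin.zero    j           _         = refl
punchIn≡suc (Fin.suc i) (Fin.suc j) (s≤s i≤j) = cong Fin.suc (punchIn≡suc i j i≤j)

toℕ-punchIn-< : ∀ {n} (i : Fin (suc n)) (j : Fin n) → toℕ j < toℕ i → toℕ (punchIn i j) ≡ toℕ j
toℕ-punchIn-< (Fin.suc i) Fin.zero    _         = refl
toℕ-punchIn-< (Fin.suc i) (Fin.suc j) (s≤s j<i) = cong suc (toℕ-punchIn-< i j j<i)

next-punchIn : ∀ (i y : Fin (suc m)) → toℕ i ≤ toℕ y → next (Fin.suc y) ≡ punchIn (Fin.suc i) (next y)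
next-punchIn {m} i y i≤y with toℕ y ≟ m
... | yes y≡m = trans (next-top (cong suc y≡m)) (sym (cong (punchIn (Fin.suc i)) (next-top y≡m)))
... | no  y≢m = FinP.toℕ-injective (begin
  toℕ (next (Fin.suc y))                  ≡⟨ toℕ-next-< (s≤s y<m) ⟩
  suc (suc (toℕ y))                       ≡⟨ cong suc (toℕ-next-< y<m) ⟨
  suc (toℕ (next y))                      ≡⟨ cong toℕ (punchIn≡suc (Fin.suc i) (next y) i<next) ⟨
  toℕ (punchIn (Fin.suc i) (next y))      ∎)
  where
  open ≡-Reasoning
  y<m : toℕ y < m
  y<m = ≤∧≢⇒< (FinP.toℕ≤pred[n] y) y≢m
  i<next : suc (toℕ i) ≤ toℕ (next y)
  i<next = subst (suc (toℕ i) ≤_) (sym (toℕ-next-< y<m)) (s≤s i≤y)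

SuccFrom : ℕ → Fin (suc m) × Fin (suc m) → Set
SuccFrom t (a , b) = t ≤ toℕ a × b ≡ next a

SuccAt : ℕ → Fin (suc m) × Fin (suc m) → Set
SuccAt t (a , b) = toℕ a ≡ t × b ≡ next a

SuccFreeFrom : ℕ → List (Fin (suc m)) → Set
SuccFreeFrom t l = ¬ Any (SuccFrom t) (cyclicPairs l)

HasSuccAt : ℕ → List (Fin (suc m)) → Set
HasSuccAt t l = Any (SuccAt t) (cyclicPairs l)

succFreeFrom? : ∀ t → Decidable (SuccFreeFrom {m} t)
succFreeFrom? t l = ¬? (Any.any? (λ (a , b) → (t ≤? toℕ a) ×-dec (b Fin.≟ next a)) (cyclicPairs l))

hasSuccAt? : ∀ t → Decidable (HasSuccAt {m} t)
hasSuccAt? t l = Any.any? (λ (a , b) → (toℕ a ≟ t) ×-dec (b Fin.≟ next a)) (cyclicPairs l)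

succFreeFrom-top : ∀ (l : List (Fin (suc m))) → SuccFreeFrom (suc m) l
succFreeFrom-top l succ with (a , _) , _ , m<a , _ ← find succ = <⇒≱ (FinP.toℕ<n a) m<a

succFrom-suc : ∀ {t} {p : Fin (suc m) × Fin (suc m)} → SuccFrom t p → SuccFrom (suc t) p ⊎ SuccAt t p
succFrom-suc {t = t} {a , _} (t≤a , b≡next) with toℕ a ≟ t
... | yes a≡t = inj₂ (a≡t , b≡next)
... | no  a≢t = inj₁ (≤∧≢⇒< t≤a (a≢t ∘ sym) , b≡next)

succFreeFrom-suc : ∀ {t} (l : List (Fin (suc m))) →
  SuccFreeFrom t l ⇔ (SuccFreeFrom (suc t) l × ¬ HasSuccAt t l)
succFreeFrom-suc {t = t} l = mk⇔
  (λ free → free ∘ Any.map (Product.map₁ (≤-trans (n≤1+n t))) ,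
            free ∘ Any.map (Product.map₁ (≤-reflexive ∘ sym)))
  (λ (free , ¬has) → [ free , ¬has ]′ ∘ Any-⊎⁻ ∘ Any.map succFrom-suc)

CircSuccFree : ∀ m → ℕ → List (Fin (suc m)) → Set
CircSuccFree m t l = IsCircRep (suc m) l × SuccFreeFrom t l

circSuccFree? : ∀ m t → Decidable (CircSuccFree m t)
circSuccFree? m t = isCircRep? (suc m) ∩? succFreeFrom? t

CircSuccAt : ∀ m → ℕ → List (Fin (suc m)) → Set
CircSuccAt m t l = CircSuccFree m (suc t) l × HasSuccAt t l

circSuccAt? : ∀ m t → Decidable (CircSuccAt m t)
circSuccAt? m t = circSuccFree? m (suc t) ∩? hasSuccAt? t

succFreeCount : ℕ → ℕ → ℕ
succFreeCount m t = count (suc m) (suc m) (circSuccFree? m t)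

succAtCount : ℕ → ℕ → ℕ
succAtCount m t = count (suc m) (suc m) (circSuccAt? m t)

succFreeCount-top : ∀ m → succFreeCount m (suc m) ≡ m !
succFreeCount-top m = trans
  (count-cong {m = suc m} (circSuccFree? m (suc m)) (isCircRep? (suc m)) proj₁ (λ {l} c → c , succFreeFrom-top l))
  (count-circRep m)

succFreeCount-split : ∀ m t → succFreeCount m (suc t) ≡ succAtCount m t + succFreeCount m t
succFreeCount-split m t = trans (count-split {m = suc m} (circSuccFree? m (suc t)) (hasSuccAt? t))
  (cong (λ x → succAtCount m t + x) (count-cong {m = suc m} _ (circSuccFree? m t)
    (λ {l} ((c , free) , ¬has) → c , Equivalence.from (succFreeFrom-suc l) (free , ¬has))
    (λ {l} (c , free) → let (free′ , ¬has) = Equivalence.to (succFreeFrom-suc l) free in (c , free′) , ¬has)))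

-- Contracting a succession

module Contraction {m : ℕ} (i : Fin (suc m)) where

  σ : Fin (suc (suc m))
  σ = Fin.suc i

  ↑ : Fin (suc m) → Fin (suc (suc m))
  ↑ = punchIn σ

  ι : Fin (suc (suc m))
  ι = ↑ i

  expand : List (Fin (suc m)) → List (Fin (suc (suc m)))
  expand []       = []
  expand (y ∷ ys) = ↑ y ∷ consIf (y Fin.≟ i) σ (expand ys)

  ↑-injective : ∀ {y z} → ↑ y ≡ ↑ z → y ≡ z
  ↑-injective = FinP.punchIn-injective σ _ _

  σ≢↑ : ∀ y → σ ≢ ↑ y
  σ≢↑ y = FinP.punchInᵢ≢i σ y ∘ sym

  toℕ-ι : toℕ ι ≡ toℕ i
  toℕ-ι = toℕ-punchIn-< σ i ≤-refl

  σ≡next-ι : σ ≡ next ι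
  σ≡next-ι = FinP.toℕ-injective (sym (trans (toℕ-next-< ι<m) (cong suc toℕ-ι)))
    where
    ι<m : toℕ ι < suc m
    ι<m = subst (_≤ suc m) (sym (cong suc toℕ-ι)) (FinP.toℕ<n i)

  succAt-ι : SuccAt (toℕ i) (ι , σ)
  succAt-ι = toℕ-ι , σ≡next-ι

  succAt⇒≡ισ : ∀ {p} → SuccAt (toℕ i) p → p ≡ (ι , σ)
  succAt⇒≡ισ {a , b} (a≡i , b≡next) =
    cong₂ _,_ a≡ι (trans b≡next (trans (cong next a≡ι) (sym σ≡next-ι)))
    where
    a≡ι : a ≡ ι
    a≡ι = FinP.toℕ-injective (trans a≡i (sym toℕ-ι))

  succFrom-suc↑ : ∀ {y} z → toℕ i ≤ toℕ y →
    SuccFrom (suc (toℕ i)) (Fin.suc y , ↑ z) ⇔ SuccFrom (toℕ i) (y , z)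
  succFrom-suc↑ {y} z i≤y = mk⇔
    (λ (_ , eq) → i≤y , ↑-injective (trans eq (next-punchIn i y i≤y)))
    (λ (_ , eq) → s≤s i≤y , trans (cong ↑ eq) (sym (next-punchIn i y i≤y)))

  succFrom-↑ : ∀ {y} z → y ≢ i → SuccFrom (suc (toℕ i)) (↑ y , ↑ z) ⇔ SuccFrom (toℕ i) (y , z)
  succFrom-↑ {y} z y≢i with <-cmp (toℕ y) (toℕ i)
  ... | tri< y<i _ _ = mk⇔
    (λ (i<↑y , _) →
      contradiction (<⇒≤ (subst (suc (toℕ i) ≤_) (toℕ-punchIn-< σ y (m<n⇒m<1+n y<i)) i<↑y)) (<⇒≱ y<i))
    (λ (i≤y , _) → contradiction i≤y (<⇒≱ y<i))
  ... | tri≈ _ y≡i _ = contradiction (FinP.toℕ-injective y≡i) y≢i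
  ... | tri> _ _ i<y rewrite punchIn≡suc σ y i<y = succFrom-suc↑ z (<⇒≤ i<y)

  ¬succFrom-ι : ¬ SuccFrom (suc (toℕ i)) (ι , σ)
  ¬succFrom-ι (i<ι , _) = <-irrefl refl (subst (suc (toℕ i) ≤_) toℕ-ι i<ι)

  succFrom-expand⁺ : ∀ y ys z → Any (SuccFrom (toℕ i)) (chainPairs y ys z) →
    Any (SuccFrom (suc (toℕ i))) (chainPairs (↑ y) (consIf (y Fin.≟ i) σ (expand ys)) (↑ z))
  succFrom-expand⁺ y ys z s with y Fin.≟ i
  succFrom-expand⁺ y []        z (here s)  | yes refl = there (here (Equivalence.from (succFrom-suc↑ z ≤-refl) s))
  succFrom-expand⁺ y []        z (here s)  | no y≢i   = here (Equivalence.from (succFrom-↑ z y≢i) s)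
  succFrom-expand⁺ y (y′ ∷ ys) z (here s)  | yes refl = there (here (Equivalence.from (succFrom-suc↑ y′ ≤-refl) s))
  succFrom-expand⁺ y (y′ ∷ ys) z (here s)  | no y≢i   = here (Equivalence.from (succFrom-↑ y′ y≢i) s)
  succFrom-expand⁺ y (y′ ∷ ys) z (there s) | yes refl = there (there (succFrom-expand⁺ y′ ys z s))
  succFrom-expand⁺ y (y′ ∷ ys) z (there s) | no _     = there (succFrom-expand⁺ y′ ys z s)

  succFrom-expand⁻ : ∀ y ys z →
    Any (SuccFrom (suc (toℕ i))) (chainPairs (↑ y) (consIf (y Fin.≟ i) σ (expand ys)) (↑ z)) →
    Any (SuccFrom (toℕ i)) (chainPairs y ys z)
  succFrom-expand⁻ y ys z s with y Fin.≟ i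
  succFrom-expand⁻ y ys        z (here s)          | yes refl = contradiction s ¬succFrom-ι
  succFrom-expand⁻ y []        z (there (here s))  | yes refl = here (Equivalence.to (succFrom-suc↑ z ≤-refl) s)
  succFrom-expand⁻ y (y′ ∷ ys) z (there (here s))  | yes refl = here (Equivalence.to (succFrom-suc↑ y′ ≤-refl) s)
  succFrom-expand⁻ y (y′ ∷ ys) z (there (there s)) | yes refl = there (succFrom-expand⁻ y′ ys z s)
  succFrom-expand⁻ y []        z (here s)          | no y≢i   = here (Equivalence.to (succFrom-↑ z y≢i) s)
  succFrom-expand⁻ y (y′ ∷ ys) z (here s)          | no y≢i   = here (Equivalence.to (succFrom-↑ y′ y≢i) s)
  succFrom-expand⁻ y (y′ ∷ ys) z (there s)         | no _     = there (succFrom-expand⁻ y′ ys z s)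

  expand-succFree : ∀ l → SuccFreeFrom (toℕ i) l → SuccFreeFrom (suc (toℕ i)) (expand l)
  expand-succFree []       _    ()
  expand-succFree (y ∷ ys) free = free ∘ succFrom-expand⁻ y ys y

  expand-succFree⁻ : ∀ l → SuccFreeFrom (suc (toℕ i)) (expand l) → SuccFreeFrom (toℕ i) l
  expand-succFree⁻ []       _    ()
  expand-succFree⁻ (y ∷ ys) free = free ∘ succFrom-expand⁺ y ys y

  expand-++ : ∀ xs ys → expand (xs ++ ys) ≡ expand xs ++ expand ys
  expand-++ []       ys = refl
  expand-++ (x ∷ xs) ys with x Fin.≟ i
  ... | yes _ = cong (λ r → ↑ x ∷ σ ∷ r) (expand-++ xs ys)
  ... | no  _ = cong (↑ x ∷_) (expand-++ xs ys)

  expand-i : ∀ ys → expand (i ∷ ys) ≡ ι ∷ σ ∷ expand ys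
  expand-i ys with i Fin.≟ i
  ... | yes _   = refl
  ... | no i≢i = contradiction refl i≢i

  expand-fresh : ∀ {ys} → All (i ≢_) ys → expand ys ≡ map ↑ ys
  expand-fresh {[]}     []           = refl
  expand-fresh {y ∷ ys} (i≢y ∷ i∉) with y Fin.≟ i
  ... | yes y≡i = contradiction (sym y≡i) i≢y
  ... | no  _   = cong (↑ y ∷_) (expand-fresh i∉)

  remove-expand : ∀ ys → remove σ (expand ys) ≡ ys
  remove-expand []       = refl
  remove-expand (y ∷ ys) = begin
    remove σ (↑ y ∷ consIf (y Fin.≟ i) σ (expand ys))
      ≡⟨ remove-other _ (σ≢↑ y) ⟩
    punchOut (σ≢↑ y) ∷ remove σ (consIf (y Fin.≟ i) σ (expand ys))
      ≡⟨ cong₂ _∷_ (FinP.punchOut-punchIn σ) (skip-σ (y Fin.≟ i)) ⟩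
    y ∷ ys ∎
    where
    open ≡-Reasoning
    skip-σ : ∀ {P : Set} (d : Dec P) → remove σ (consIf d σ (expand ys)) ≡ ys
    skip-σ (yes _) = trans (remove-self (expand ys)) (remove-expand ys)
    skip-σ (no  _) = remove-expand ys

  remove-ισ : ∀ q → remove σ (ι ∷ σ ∷ q) ≡ i ∷ remove σ q
  remove-ισ q = trans (remove-other (σ ∷ q) (σ≢↑ i)) (cong₂ _∷_ (FinP.punchOut-punchIn σ) (remove-self q))

  expand-split : ∀ p q → Unique (p ++ i ∷ q) → expand (p ++ i ∷ q) ≡ map ↑ p ++ ι ∷ σ ∷ map ↑ q
  expand-split p q u with i∉q ∷ _ ← unique-++⁻ʳ p u = begin
    expand (p ++ i ∷ q)            ≡⟨ expand-++ p (i ∷ q) ⟩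
    expand p ++ expand (i ∷ q)     ≡⟨ cong₂ _++_ (expand-fresh (unique-++-fresh p u (here refl))) (expand-i q) ⟩
    map ↑ p ++ ι ∷ σ ∷ expand q    ≡⟨ cong (λ r → map ↑ p ++ ι ∷ σ ∷ r) (expand-fresh i∉q) ⟩
    map ↑ p ++ ι ∷ σ ∷ map ↑ q     ∎
    where open ≡-Reasoning

  expand-remove : ∀ p q → Unique (p ++ ι ∷ σ ∷ q) → expand (remove σ (p ++ ι ∷ σ ∷ q)) ≡ p ++ ι ∷ σ ∷ q
  expand-remove p q u with _ ∷ σ∉q ∷ _ ← unique-++⁻ʳ p u = begin
    expand (remove σ (p ++ ι ∷ σ ∷ q))
      ≡⟨ cong expand removed ⟩
    expand (remove σ p ++ i ∷ remove σ q)
      ≡⟨ expand-split (remove σ p) (remove σ q) (subst Unique removed (remove-unique u)) ⟩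
    map ↑ (remove σ p) ++ ι ∷ σ ∷ map ↑ (remove σ q)
      ≡⟨ cong₂ (λ xs ys → xs ++ ι ∷ σ ∷ ys) (map-punchIn-remove-∉ σ∉p) (map-punchIn-remove-∉ σ∉q) ⟩
    p ++ ι ∷ σ ∷ q ∎
    where
    open ≡-Reasoning
    removed : remove σ (p ++ ι ∷ σ ∷ q) ≡ remove σ p ++ i ∷ remove σ q
    removed = trans (remove-++ p (ι ∷ σ ∷ q)) (cong (remove σ p ++_) (remove-ισ q))
    σ∉p : All (σ ≢_) p
    σ∉p = unique-++-fresh p u (there (here refl))

  succAt-split : ∀ xs → HasSuccAt (toℕ i) (Fin.zero ∷ xs) → ∃₂ λ p q → Fin.zero ∷ xs ≡ p ++ ι ∷ σ ∷ q
  succAt-split xs has with _ , pair∈ , at ← find has with refl ← succAt⇒≡ισ at with ∈-chainPairs⁻ xs pair∈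
  ... | inj₁ split       = split
  ... | inj₂ (() , _)

  succAtCount-contract : succAtCount (suc m) (toℕ i) ≡ succFreeCount m (toℕ i)
  succAtCount-contract = count-bijection {m = suc (suc m)} {m′ = suc m}
    (circSuccAt? (suc m) (toℕ i)) (circSuccFree? m (toℕ i))
    (remove σ) expand remove-maps expand-maps expand∘remove (λ {l} _ → remove-expand l)
    where
    expand∘remove : ∀ {l} → CircSuccAt (suc m) (toℕ i) l → expand (remove σ l) ≡ l
    expand∘remove {Fin.zero ∷ xs} (((_ , u) , _) , has) with p , q , eq ← succAt-split xs has =
      trans (cong (expand ∘ remove σ) eq) (trans (expand-remove p q (subst Unique eq u)) (sym eq))

    remove-maps : ∀ {l} → length l ≡ suc (suc m) → CircSuccAt (suc m) (toℕ i) l →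
      length (remove σ l) ≡ suc m × CircSuccFree m (toℕ i) (remove σ l)
    remove-maps {Fin.zero ∷ xs} len linked@(((_ , u) , free) , has) with p , q , eq ← succAt-split xs has =
      cong pred (trans (length-remove-∈ u σ∈) len) ,
      (subst StartsWith1 (sym (remove-other {h = σ} {y = Fin.zero} xs λ ())) refl , remove-unique {h = σ} u) ,
      expand-succFree⁻ _ (subst (SuccFreeFrom _) (sym (expand∘remove linked)) free)
      where
      σ∈ : σ ∈ Fin.zero ∷ xs
      σ∈ = subst (σ ∈_) (sym eq) (∈-++⁺ʳ p (there (here refl)))

    expand-maps : ∀ {l} → length l ≡ suc m → CircSuccFree m (toℕ i) l →
      length (expand l) ≡ suc (suc m) × CircSuccAt (suc m) (toℕ i) (expand l)
    expand-maps {l@(Fin.zero ∷ t)} len ((_ , u) , free) with p , q , eq ← ∈-∃++ (unique-full u len i) =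
      trans (sym (length-remove-∈ u′ σ∈)) (cong suc (trans (cong length (remove-expand l)) len)) ,
      ((refl , u′) , expand-succFree l free) ,
      lose (∈-chainPairs⁺ (map ↑ p) split) succAt-ι
      where
      split : expand l ≡ map ↑ p ++ ι ∷ σ ∷ map ↑ q
      split = trans (cong expand eq) (expand-split p q (subst Unique eq u))
      ↑l≡ : map ↑ l ≡ map ↑ p ++ ι ∷ map ↑ q
      ↑l≡ = trans (cong (map ↑) eq) (map-++ ↑ p (i ∷ q))
      u′ : Unique (expand l)
      u′ = subst Unique (sym split)
        (unique-insertAfter (map ↑ p) (subst Unique ↑l≡ (punchIn-unique u))
                                      (subst (All (σ ≢_)) ↑l≡ (punchIn-fresh l)))
      σ∈ : σ ∈ expand l
      σ∈ = subst (σ ∈_) (sym split) (∈-++⁺ʳ (map ↑ p) (there (here refl)))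

module Wrap (m : ℕ) where

  L : Fin (suc (suc m))
  L = Fin.fromℕ (suc m)

  ↑ : Fin (suc m) → Fin (suc (suc m))
  ↑ = punchIn L

  close : List (Fin (suc m)) → List (Fin (suc (suc m)))
  close l = map ↑ l ++ [ L ]

  succAt-L : SuccAt (suc m) (L , Fin.zero)
  succAt-L = FinP.toℕ-fromℕ (suc m) , sym (next-top (FinP.toℕ-fromℕ (suc m)))

  succAt⇒≡L0 : ∀ {p} → SuccAt (suc m) p → p ≡ (L , Fin.zero)
  succAt⇒≡L0 {a , b} (a≡m , b≡next) = cong₂ _,_ a≡L (trans b≡next (next-top a≡m))
    where
    a≡L : a ≡ L
    a≡L = FinP.toℕ-injective (trans a≡m (sym (FinP.toℕ-fromℕ (suc m))))

  succAt-split : ∀ xs → Unique (Fin.zero ∷ xs) → HasSuccAt (suc m) (Fin.zero ∷ xs) →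
    ∃ λ p → Fin.zero ∷ xs ≡ p ++ [ L ]
  succAt-split xs u has with _ , pair∈ , at ← find has with refl ← succAt⇒≡L0 at with ∈-chainPairs⁻ xs pair∈
  ... | inj₂ (_ , split)           = split
  ... | inj₁ ([] , _ , eq)         = contradiction (∷-injectiveˡ eq) λ ()
  ... | inj₁ (x ∷ p , q , eq) with 0≢x ∷ _ ← unique-++-fresh (x ∷ p) (subst Unique eq u) (there (here refl))
    = contradiction (∷-injectiveˡ eq) 0≢x

  remove-close : ∀ l → remove L (close l) ≡ l
  remove-close l = begin
    remove L (map ↑ l ++ [ L ])            ≡⟨ remove-++ (map ↑ l) [ L ] ⟩
    remove L (map ↑ l) ++ remove L [ L ]   ≡⟨ cong₂ _++_ (remove-map-punchIn l) (remove-self {h = L} []) ⟩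
    l ++ []                                ≡⟨ ++-identityʳ l ⟩
    l                                      ∎
    where open ≡-Reasoning

  close-remove : ∀ p → Unique (p ++ [ L ]) → close (remove L (p ++ [ L ])) ≡ p ++ [ L ]
  close-remove p u = cong (_++ [ L ]) (begin
    map ↑ (remove L (p ++ [ L ]))              ≡⟨ cong (map ↑) (remove-++ p [ L ]) ⟩
    map ↑ (remove L p ++ remove L [ L ])       ≡⟨ cong (λ r → map ↑ (remove L p ++ r)) (remove-self {h = L} []) ⟩
    map ↑ (remove L p ++ [])                   ≡⟨ cong (map ↑) (++-identityʳ (remove L p)) ⟩
    map ↑ (remove L p)                         ≡⟨ map-punchIn-remove-∉ (unique-++-fresh p u (here refl)) ⟩
    p                                          ∎)
    where open ≡-Reasoning

  close-unique : ∀ {l} → Unique l → Unique (close l)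
  close-unique {l} u = Unique.++⁺ (punchIn-unique u) ([] ∷ [])
    λ { (x∈ , here x≡L) → All.lookup (punchIn-fresh l) x∈ (sym x≡L) }

  succAtCount-top : succAtCount (suc m) (suc m) ≡ m !
  succAtCount-top = trans (count-bijection {m = suc (suc m)} {m′ = suc m}
    (circSuccAt? (suc m) (suc m)) (isCircRep? (suc m))
    (remove L) close remove-maps close-maps close∘remove (λ {l} _ → remove-close l))
    (count-circRep m)
    where
    close∘remove : ∀ {l} → CircSuccAt (suc m) (suc m) l → close (remove L l) ≡ l
    close∘remove {Fin.zero ∷ xs} (((_ , u) , _) , has) with p , eq ← succAt-split xs u has =
      trans (cong (close ∘ remove L) eq) (trans (close-remove p (subst Unique eq u)) (sym eq))

    remove-maps : ∀ {l} → length l ≡ suc (suc m) → CircSuccAt (suc m) (suc m) l →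
      length (remove L l) ≡ suc m × IsCircRep (suc m) (remove L l)
    remove-maps {Fin.zero ∷ xs} len (((_ , u) , _) , has) with p , eq ← succAt-split xs u has =
      cong pred (trans (length-remove-∈ u L∈) len) ,
      subst StartsWith1 (sym (remove-other {h = L} {y = Fin.zero} xs λ ())) refl , remove-unique {h = L} u
      where
      L∈ : L ∈ Fin.zero ∷ xs
      L∈ = subst (L ∈_) (sym eq) (∈-++⁺ʳ p (here refl))

    close-maps : ∀ {l} → length l ≡ suc m → IsCircRep (suc m) l →
      length (close l) ≡ suc (suc m) × CircSuccAt (suc m) (suc m) (close l)
    close-maps {l@(Fin.zero ∷ t)} len (_ , u) =
      trans (sym (length-remove-∈ (close-unique u) (∈-++⁺ʳ (map ↑ l) (here refl))))
            (cong suc (trans (cong length (remove-close l)) len)) ,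
      ((refl , close-unique u) , succFreeFrom-top (close l)) ,
      lose (∈-chainPairs⁺-last (map ↑ l) refl) succAt-L

succAtCount≡succFreeCount : ∀ {m i} → i ≤ suc m → succAtCount (suc m) i ≡ succFreeCount m i
succAtCount≡succFreeCount {m} {i} i≤1+m with m≤n⇒m<n∨m≡n i≤1+m
... | inj₁ i<1+m = subst (λ t → succAtCount (suc m) t ≡ succFreeCount m t) (FinP.toℕ-fromℕ< i<1+m)
                         (Contraction.succAtCount-contract (Fin.fromℕ< i<1+m))
... | inj₂ refl  = trans (Wrap.succAtCount-top m) (sym (succFreeCount-top m))

succFreeCount-pascal : ∀ {m i} → i ≤ suc m →
  succFreeCount (suc m) (suc i) ≡ succFreeCount m i + succFreeCount (suc m) i
succFreeCount-pascal {m} {i} i≤1+m =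
  trans (succFreeCount-split (suc m) i) (cong (λ x → x + succFreeCount (suc m) i) (succAtCount≡succFreeCount i≤1+m))

-- The alternating sum

altTerm : ℕ → ℕ → ℕ → ℤ
altTerm n e j = -1ℤ ℤ.^ j ℤ.* + ((e C j) * (n ∸ j ∸ 1) !)

altSum : ℕ → ℕ → ℤ
altSum n e = sum {suc e} (λ j → altTerm n e (toℕ j))

sum-snoc : ∀ (f : ℕ → ℤ) n → sum {suc n} (λ j → f (toℕ j)) ≡ sum {n} (λ j → f (toℕ j)) ℤ.+ f n
sum-snoc f n = begin
  sum {suc n} (λ j → f (toℕ j))
    ≡⟨ sum-init-last {n} (λ j → f (toℕ j)) ⟩
  sum {n} (λ j → f (toℕ (Fin.inject₁ j))) ℤ.+ f (toℕ (Fin.fromℕ n))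
    ≡⟨ cong₂ ℤ._+_ (sum-cong-≗ {n} (cong f ∘ FinP.toℕ-inject₁)) (cong f (FinP.toℕ-fromℕ n)) ⟩
  sum {n} (λ j → f (toℕ j)) ℤ.+ f n ∎
  where open ≡-Reasoning

altSum-zero : ∀ n → altSum n 0 ≡ + ((n ∸ 1) !)
altSum-zero n = trans (ℤP.+-identityʳ (altTerm n 0 0))
  (trans (ℤP.*-identityˡ (+ (1 * (n ∸ 1) !))) (cong +_ (*-identityˡ ((n ∸ 1) !))))

altTerm-pascal : ∀ n e j → altTerm (suc n) (suc e) (suc j) ℤ.+ altTerm n e j ≡ altTerm (suc n) e (suc j)
altTerm-pascal n e j = begin
  -s ℤ.* + ((suc e C suc j) * f) ℤ.+ s ℤ.* a
    ≡⟨ cong (λ c → -s ℤ.* + (c * f) ℤ.+ s ℤ.* a) (nCk+nC[k+1]≡[n+1]C[k+1] e j) ⟨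
  -s ℤ.* + ((e C j + e C suc j) * f) ℤ.+ s ℤ.* a
    ≡⟨ cong (λ x → -s ℤ.* x ℤ.+ s ℤ.* a) (trans (cong +_ (*-distribʳ-+ f (e C j) (e C suc j)))
                                                (ℤP.pos-+ ((e C j) * f) ((e C suc j) * f))) ⟩
  -s ℤ.* (a ℤ.+ b) ℤ.+ s ℤ.* a
    ≡⟨ regroup s a b ⟩
  -s ℤ.* b ∎
  where
  open ≡-Reasoning
  f : ℕ
  f = (n ∸ j ∸ 1) !
  s -s a b : ℤ
  s = -1ℤ ℤ.^ j
  -s = -1ℤ ℤ.* s
  a = + ((e C j) * f)
  b = + ((e C suc j) * f)
  regroup : ∀ s a b → -1ℤ ℤ.* s ℤ.* (a ℤ.+ b) ℤ.+ s ℤ.* a ≡ -1ℤ ℤ.* s ℤ.* b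
  regroup = solve-∀

altTerm-top : ∀ n e → altTerm n e (suc e) ≡ + 0
altTerm-top n e = trans (cong (λ c → -1ℤ ℤ.^ suc e ℤ.* + (c * (n ∸ suc e ∸ 1) !)) (k>n⇒nCk≡0 (n<1+n e)))
                        (ℤP.*-zeroʳ (-1ℤ ℤ.^ suc e))

altTerm-diag : ∀ n → altTerm n n n ≡ -1ℤ ℤ.^ n
altTerm-diag n rewrite nCn≡1 n | n∸n≡0 n = ℤP.*-identityʳ (-1ℤ ℤ.^ n)

altSum-pascal : ∀ n e → altSum (suc n) (suc e) ℤ.+ altSum n e ≡ altSum (suc n) e
altSum-pascal n e = begin
  t 0 ℤ.+ sum {suc e} (λ j → t (suc (toℕ j))) ℤ.+ sum {suc e} (λ j → u (toℕ j))
    ≡⟨ ℤP.+-assoc (t 0) _ _ ⟩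
  t 0 ℤ.+ (sum {suc e} (λ j → t (suc (toℕ j))) ℤ.+ sum {suc e} (λ j → u (toℕ j)))
    ≡⟨ cong (λ x → t 0 ℤ.+ x) (∑-distrib-+ {suc e} (λ j → t (suc (toℕ j))) (λ j → u (toℕ j))) ⟨
  t 0 ℤ.+ sum {suc e} (λ j → t (suc (toℕ j)) ℤ.+ u (toℕ j))
    ≡⟨ cong (λ x → t 0 ℤ.+ x) (sum-cong-≗ {suc e} (λ j → altTerm-pascal n e (toℕ j))) ⟩
  sum {suc (suc e)} (λ j → v (toℕ j))
    ≡⟨ sum-snoc v (suc e) ⟩
  altSum (suc n) e ℤ.+ v (suc e)
    ≡⟨ cong (λ x → altSum (suc n) e ℤ.+ x) (altTerm-top (suc n) e) ⟩
  altSum (suc n) e ℤ.+ + 0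
    ≡⟨ ℤP.+-identityʳ (altSum (suc n) e) ⟩
  altSum (suc n) e ∎
  where
  open ≡-Reasoning
  t u v : ℕ → ℤ
  t = altTerm (suc n) (suc e)
  u = altTerm n e
  v = altTerm (suc n) e

foldr-applyUpTo : ∀ (f : ℕ → ℤ) (g : ℕ → ℕ) n →
  foldr ℤ._+_ (+ 0) (map f (applyUpTo g n)) ≡ sum {n} (λ j → f (g (toℕ j)))
foldr-applyUpTo f g zero    = refl
foldr-applyUpTo f g (suc n) = cong (λ x → f (g 0) ℤ.+ x) (foldr-applyUpTo f (g ∘ suc) n)

rhs≡altSum : ∀ n → rhs n ≡ altSum n n
rhs≡altSum n = begin
  rhs n
    ≡⟨ cong (ℤ._+ -1ℤ ℤ.^ n) (foldr-applyUpTo (altTerm n n) id n) ⟩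
  sum {n} (λ j → altTerm n n (toℕ j)) ℤ.+ -1ℤ ℤ.^ n
    ≡⟨ cong (λ x → sum {n} (λ j → altTerm n n (toℕ j)) ℤ.+ x) (altTerm-diag n) ⟨
  sum {n} (λ j → altTerm n n (toℕ j)) ℤ.+ altTerm n n n
    ≡⟨ sum-snoc (altTerm n n) n ⟨
  altSum n n ∎
  where open ≡-Reasoning

succFreeCount≡altSum : ∀ e {m i} → i + e ≡ suc m → + succFreeCount m i ≡ altSum (suc m) e
succFreeCount≡altSum zero {m} {i} i+0≡1+m with refl ← trans (sym (+-identityʳ i)) i+0≡1+m =
  trans (cong +_ (succFreeCount-top m)) (sym (altSum-zero (suc m)))
-- n = 1: both sides evaluate to 0.
succFreeCount≡altSum (suc e) {zero} {i} i+1+e≡1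
  with i+e≡0 ← suc-injective (trans (sym (+-suc i e)) i+1+e≡1)
  with refl ← m+n≡0⇒m≡0 i i+e≡0 | refl ← m+n≡0⇒n≡0 i i+e≡0 = refl
succFreeCount≡altSum (suc e) {suc m} {i} i+1+e≡2+m = ∙-cancelʳ (altSum (suc m) e) _ _ (begin
  + F₁ i ℤ.+ altSum (suc m) e                ≡⟨ cong (λ x → + F₁ i ℤ.+ x) (succFreeCount≡altSum e i+e≡1+m) ⟨
  + F₁ i ℤ.+ + succFreeCount m i             ≡⟨ ℤP.+-comm (+ F₁ i) (+ succFreeCount m i) ⟩
  + succFreeCount m i ℤ.+ + F₁ i             ≡⟨ ℤP.pos-+ (succFreeCount m i) (F₁ i) ⟨
  + (succFreeCount m i + F₁ i)               ≡⟨ cong +_ (succFreeCount-pascal (m+n≤o⇒m≤o i (≤-reflexive i+e≡1+m))) ⟨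
  + F₁ (suc i)                               ≡⟨ succFreeCount≡altSum e 1+i+e≡2+m ⟩
  altSum (suc (suc m)) e                     ≡⟨ altSum-pascal (suc m) e ⟨
  altSum (suc (suc m)) (suc e) ℤ.+ altSum (suc m) e ∎)
  where
  open ≡-Reasoning
  F₁ : ℕ → ℕ
  F₁ = succFreeCount (suc m)
  1+i+e≡2+m : suc i + e ≡ suc (suc m)
  1+i+e≡2+m = trans (sym (+-suc i e)) i+1+e≡2+m
  i+e≡1+m : i + e ≡ suc m
  i+e≡1+m = suc-injective 1+i+e≡2+m

-- Multiplication modulo n

module _ (n : ℕ) .{{_ : NonZero n}} where

  [m%n*o]%n≡[m*o]%n : ∀ a b → ((a % n) * b) % n ≡ (a * b) % n
  [m%n*o]%n≡[m*o]%n a b = begin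
    ((a % n) * b) % n            ≡⟨ %-distribˡ-* (a % n) b n ⟩
    ((a % n % n) * (b % n)) % n  ≡⟨ cong (λ x → (x * (b % n)) % n) (m%n%n≡m%n a n) ⟩
    ((a % n) * (b % n)) % n      ≡⟨ %-distribˡ-* a b n ⟨
    (a * b) % n                  ∎
    where open ≡-Reasoning

  [m*[n%o]]%o≡[m*n]%o : ∀ a b → (a * (b % n)) % n ≡ (a * b) % n
  [m*[n%o]]%o≡[m*n]%o a b = begin
    (a * (b % n)) % n  ≡⟨ cong (_% n) (*-comm a (b % n)) ⟩
    ((b % n) * a) % n  ≡⟨ [m%n*o]%n≡[m*o]%n b a ⟩
    (b * a) % n        ≡⟨ cong (_% n) (*-comm b a) ⟩
    (a * b) % n        ∎
    where open ≡-Reasoning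

  [m%n+o]%n≡[m+o]%n : ∀ a b → ((a % n) + b) % n ≡ (a + b) % n
  [m%n+o]%n≡[m+o]%n a b = begin
    ((a % n) + b) % n            ≡⟨ %-distribˡ-+ (a % n) b n ⟩
    ((a % n % n) + (b % n)) % n  ≡⟨ cong (λ x → (x + (b % n)) % n) (m%n%n≡m%n a n) ⟩
    ((a % n) + (b % n)) % n      ≡⟨ %-distribˡ-+ a b n ⟨
    (a + b) % n                  ∎
    where open ≡-Reasoning

  scale : ℕ → Fin n → Fin n
  scale c a = (c * toℕ a) mod n

  toℕ-scale : ∀ c a → toℕ (scale c a) ≡ (c * toℕ a) % n
  toℕ-scale c a = FinP.toℕ-fromℕ< _

  scale-scale : ∀ c d → (c * d) % n ≡ 1 % n → ∀ a → scale c (scale d a) ≡ a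
  scale-scale c d cd≡1 a = FinP.toℕ-injective (begin
    toℕ (scale c (scale d a))    ≡⟨ toℕ-scale c (scale d a) ⟩
    (c * toℕ (scale d a)) % n    ≡⟨ cong (λ x → (c * x) % n) (toℕ-scale d a) ⟩
    (c * ((d * toℕ a) % n)) % n  ≡⟨ [m*[n%o]]%o≡[m*n]%o c (d * toℕ a) ⟩
    (c * (d * toℕ a)) % n        ≡⟨ cong (_% n) (*-assoc c d (toℕ a)) ⟨
    (c * d * toℕ a) % n          ≡⟨ [m%n*o]%n≡[m*o]%n (c * d) (toℕ a) ⟨
    ((c * d) % n * toℕ a) % n    ≡⟨ cong (λ x → (x * toℕ a) % n) cd≡1 ⟩
    ((1 % n) * toℕ a) % n        ≡⟨ [m%n*o]%n≡[m*o]%n 1 (toℕ a) ⟩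
    (1 * toℕ a) % n              ≡⟨ cong (_% n) (*-identityˡ (toℕ a)) ⟩
    toℕ a % n                    ≡⟨ m<n⇒m%n≡m (FinP.toℕ<n a) ⟩
    toℕ a                        ∎)
    where open ≡-Reasoning

module _ {m : ℕ} where

  toℕ-scale-next : ∀ c (a : Fin (suc m)) → toℕ (scale (suc m) c (next a)) ≡ (toℕ (scale (suc m) c a) + c) % suc m
  toℕ-scale-next c a = begin
    toℕ (scale (suc m) c (next a))           ≡⟨ toℕ-scale (suc m) c (next a) ⟩
    (c * toℕ (next a)) % suc m               ≡⟨ cong (λ x → (c * x) % suc m) (toℕ-next a) ⟩
    (c * (suc (toℕ a) % suc m)) % suc m      ≡⟨ [m*[n%o]]%o≡[m*n]%o (suc m) c (suc (toℕ a)) ⟩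
    (c * suc (toℕ a)) % suc m                ≡⟨ cong (_% suc m) (trans (*-suc c (toℕ a)) (+-comm c (c * toℕ a))) ⟩
    (c * toℕ a + c) % suc m                  ≡⟨ [m%n+o]%n≡[m+o]%n (suc m) (c * toℕ a) c ⟨
    ((c * toℕ a) % suc m + c) % suc m        ≡⟨ cong (λ x → (x + c) % suc m) (toℕ-scale (suc m) c a) ⟨
    (toℕ (scale (suc m) c a) + c) % suc m    ∎
    where open ≡-Reasoning

  modularInverse : ∀ {k} → gcd (suc m) k ≡ 1 → ∃ λ k′ → (k′ * k) % suc m ≡ 1 % suc m
  modularInverse {k} gcd≡1 with coprime-Bézout (gcd≡1⇒coprime gcd≡1)
  ... | Bézout.-+ x y eq = y , trans (cong (_% suc m) (sym eq)) ([m+kn]%n≡m%n 1 x (suc m))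
  ... | Bézout.+- x y eq = y * m , (begin
    (y * m * k) % suc m                ≡⟨ [m+n]%n≡m%n (y * m * k) (suc m) ⟨
    (y * m * k + suc m) % suc m        ≡⟨ cong (_% suc m) (rearrange y m k) ⟩
    ((1 + y * k) * m + 1) % suc m      ≡⟨ cong (λ z → (z * m + 1) % suc m) eq ⟩
    (x * suc m * m + 1) % suc m        ≡⟨ cong (_% suc m) (rearrange′ x m) ⟩
    (1 + x * m * suc m) % suc m        ≡⟨ [m+kn]%n≡m%n 1 (x * m) (suc m) ⟩
    1 % suc m                          ∎)
    where
    open ≡-Reasoning
    rearrange : ∀ y m k → y * m * k + suc m ≡ (1 + y * k) * m + 1
    rearrange = ℕ-Solver.solve-∀
    rearrange′ : ∀ x m → x * suc m * m + 1 ≡ 1 + x * m * suc m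
    rearrange′ = ℕ-Solver.solve-∀

  scale-zero : ∀ c {a} → toℕ a ≡ 0 → toℕ (scale (suc m) c a) ≡ 0
  scale-zero c {a} a≡0 =
    trans (toℕ-scale (suc m) c a) (trans (cong (λ x → (c * x) % suc m) a≡0) (cong (_% suc m) (*-zeroʳ c)))


module Relabel {m k : ℕ} (gcd≡1 : gcd (suc m) k ≡ 1) where

  private
    inverse : ∃ λ k′ → (k′ * k) % suc m ≡ 1 % suc m
    inverse = modularInverse gcd≡1
    k′ : ℕ
    k′ = proj₁ inverse

  ν μ : Fin (suc m) → Fin (suc m)
  ν = scale (suc m) k
  μ = scale (suc m) k′

  μ∘ν : ∀ a → μ (ν a) ≡ a
  μ∘ν = scale-scale (suc m) k′ k (proj₂ inverse)

  ν∘μ : ∀ a → ν (μ a) ≡ a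
  ν∘μ = scale-scale (suc m) k k′ (trans (cong (_% suc m) (*-comm k k′)) (proj₂ inverse))

  ν-step : ∀ {a b} → (toℕ (ν b) ≡ modN (suc m) (toℕ (ν a) + k)) ⇔ SuccFrom 0 (a , b)
  ν-step {a} {b} = mk⇔
    (λ eq → z≤n , leftInverse⇒injective ν μ μ∘ν (FinP.toℕ-injective (trans eq (sym (toℕ-scale-next {m} k a)))))
    (λ (_ , b≡next) → trans (cong (toℕ ∘ ν) b≡next) (toℕ-scale-next {m} k a))

  avoids⇔succFree : ∀ l → Avoids (suc m) k (map ν l) ⇔ SuccFreeFrom 0 l
  avoids⇔succFree l = mk⇔
    (λ avoids → AllP.All¬⇒¬Any (All.map (λ ¬step → ¬step ∘ Equivalence.from ν-step)
                  (AllP.map⁻ (subst (All _) (cyclicPairs-map ν l) avoids))))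
    (λ free → subst (All _) (sym (cyclicPairs-map ν l))
                (AllP.map⁺ (All.map (λ ¬succ → ¬succ ∘ Equivalence.to ν-step) (AllP.¬Any⇒All¬ _ free))))

  circAvoidCount≡succFreeCount : circAvoidCount (suc m) k ≡ succFreeCount m 0
  circAvoidCount≡succFreeCount = count-bijection {m = suc m} {m′ = suc m}
    (good? (suc m) k) (circSuccFree? m 0) (map μ) (map ν)
    (λ { {l@(_ ∷ _)} len ((x≡0 , u) , avoids) →
      trans (length-map μ l) len ,
      (scale-zero k′ x≡0 , Unique.map⁺ (leftInverse⇒injective μ ν ν∘μ) u) ,
      Equivalence.to (avoids⇔succFree _) (subst (Avoids (suc m) k) (sym (map-leftInverse μ ν ν∘μ l)) avoids) })
    (λ { {l@(_ ∷ _)} len ((x≡0 , u) , free) →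
      trans (length-map ν l) len ,
      (scale-zero k x≡0 , Unique.map⁺ (leftInverse⇒injective ν μ μ∘ν) u) ,
      Equivalence.from (avoids⇔succFree l) free })
    (λ {l} _ → map-leftInverse μ ν ν∘μ l)
    (λ {l} _ → map-leftInverse ν μ μ∘ν l)

corollary2p9 : (n k : ℕ) → 2 ≤ n → 1 ≤ k → k < n → gcd n k ≡ 1 →
    + circAvoidCount n k ≡ rhs n
corollary2p9 (suc m) k _ _ _ gcd≡1 = begin
  + circAvoidCount (suc m) k   ≡⟨ cong +_ (Relabel.circAvoidCount≡succFreeCount {m} {k} gcd≡1) ⟩
  + succFreeCount m 0          ≡⟨ succFreeCount≡altSum (suc m) {m} {0} refl ⟩
  altSum (suc m) (suc m)       ≡⟨ rhs≡altSum (suc m) ⟨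
  rhs (suc m)                  ∎
  where open ≡-Reasoning
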